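{- Let $N\geq5$ be odd. Suppose $C(X)=\sum_{n=1}^{(N-3)/2}c_{2n} X^{2n}\in\mathbb{Q}[X]$ satisfies \[ C(X)-C(1+X)-X^{N-2}C\Big(1+\frac{1}{X}\Big)=c+(\text{an odd polynomial in }X) \] for some constant $c\in\mathbb{Q}$, and that $C(X)=Xp(X)$ for a polynomial $p\in\mathbb{Q}[X]$ with $p(X)=X^{N-3}p(\frac{1}{X})$. Then $p\in W_{N-1}^+$.
   Context: For even $h>2$, $W_h$ is the space of $P\in\mathbb{Q}[X]$ with $P(X)+X^{h-2}P(-1/X)=0$ and $P(X)+X^{h-2}P(1-1/X)+(X-1)^{h-2}P(-1/(X-1))=0$; $W_h^+=\{P\in W_h: P(0)=0,\ P(X)=X^{h-2}P(1/X)\}$. -}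

module Defs where

open import Data.Nat as ℕ using (ℕ; zero; suc)
open import Data.List using (List; []; _∷_)
open import Data.Product using (_×_)
open import Data.Rational using (ℚ; 0ℚ; 1ℚ; _+_; _*_; _-_; -_; 1/_; ≢-nonZero)
open import Relation.Binary.PropositionalEquality using (_≡_; _≢_)

-- Polynomials over ℚ as coefficient lists, lowest degree first.
Poly : Set
Poly = List ℚ

eval : Poly → ℚ → ℚ
eval []      x = 0ℚ
eval (a ∷ p) x = a + x * eval p x

pow : ℚ → ℕ → ℚ
pow x zero    = 1ℚ
pow x (suc n) = x * pow x n

inv : (x : ℚ) → x ≢ 0ℚ → ℚ
inv x nz = 1/_ x {{≢-nonZero nz}}

sum1 : ℕ → (ℕ → ℚ) → ℚ
sum1 zero    f = 0ℚ
sum1 (suc K) f = sum1 K f + f (suc K)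

-- Identities of rational functions are stated pointwise at all rational
-- points where every term is defined (equivalent over the infinite field ℚ).

InW : ℕ → Poly → Set
InW h P =
  (∀ (x : ℚ) (nz : x ≢ 0ℚ) →
     eval P x + pow x (h ℕ.∸ 2) * eval P (- inv x nz) ≡ 0ℚ)
  × (∀ (x : ℚ) (nz : x ≢ 0ℚ) (nz1 : x - 1ℚ ≢ 0ℚ) →
     (eval P x + pow x (h ℕ.∸ 2) * eval P (1ℚ - inv x nz))
       + pow (x - 1ℚ) (h ℕ.∸ 2) * eval P (- inv (x - 1ℚ) nz1) ≡ 0ℚ)

InW+ : ℕ → Poly → Set
InW+ h P =
  InW h P
  × eval P 0ℚ ≡ 0ℚ
  × (∀ (x : ℚ) (nz : x ≢ 0ℚ) → eval P x ≡ pow x (h ℕ.∸ 2) * eval P (inv x nz))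

IsOdd : Poly → Set
IsOdd O = ∀ (x : ℚ) → eval O (- x) ≡ - eval O x

{-# OPTIONS --safe #-}
-- Let w = N - 3 and T(x) = P(x) + P(1 - x) + xʷ P(1 - 1/x). Since C(x) = x P(x) is even, P is odd
-- away from 0; with P(x) = xʷ P(1/x) this gives the two-term relation, gives P(0) = 0 because a
-- polynomial is continuous at 0, and turns the three-term relation into T(x) = 0 for x ≠ 0, 1.
-- T satisfies T(1 - x) = T(x) and T(x) = xʷ T(1/x), and adding the hypothesis at x and at -x
-- removes the odd polynomial, leaving (x + 1) T(x + 1) = (x - 1) T(x) - 2 c₀. At x = 1, -2 and ½
-- this forces c₀ = 0 because 2ʷ ≠ 1; then T(2) = 0 and T(x) = 0 implies T(x + 1) = 0. As
-- x ↦ x + 1 and x ↦ 1/x reach every positive rational other than 1 from 2 (Euclid's algorithm),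
-- T vanishes there, and on the negative rationals through x ↦ 1 - x.

module Submission where

open import Defs
open import Data.Nat as ℕ using (ℕ; _≤_; _∸_; _%_; _/_)
open import Data.Product using (Σ; _×_)
open import Data.Rational using (ℚ; 0ℚ; 1ℚ; _+_; _*_; _-_)
open import Relation.Binary.PropositionalEquality using (_≡_; _≢_)

open import Data.Empty using (⊥-elim)
import Data.Integer as ℤ
import Data.Integer.Properties as ℤP
open import Data.List using ([]; _∷_)
open import Data.Nat using (zero; suc; z≤n; s≤s)
open import Data.Nat.DivMod using (m*n%n≡0)
open import Data.Nat.Induction using (<-wellFounded)
import Data.Nat.Coprimality as Coprime
import Data.Nat.Properties as ℕP
open import Data.Product using (_,_)
open import Data.Rational using (mkℚ; -_; 1/_; ½; ∣_∣; Positive; NonNegative; NonZero; ≢-nonZero)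
  renaming (_≤_ to _≤ℚ_; _<_ to _<ℚ_)
import Data.Rational.Properties as ℚP
open import Algebra.Properties.Group ℚP.+-0-group using (x∙y⁻¹≈ε⇒x≈y; x≈y⇒x∙y⁻¹≈ε)
import Data.Rational.Unnormalised as ℚᵘ
import Data.Rational.Unnormalised.Properties as ℚᵘP
open import Induction.WellFounded using (Acc; acc)
open import Relation.Binary.Definitions using (tri<; tri≈; tri>)
open import Relation.Binary.PropositionalEquality using (refl; sym; trans; cong; cong₂; subst; module ≡-Reasoning)
open import Relation.Nullary.Decidable using (dec⇒maybe; yes; no)
open import Tactic.RingSolver using (solve-∀)
open import Tactic.RingSolver.Core.AlmostCommutativeRing using (AlmostCommutativeRing; fromCommutativeRing)

ℚ-ring : AlmostCommutativeRing _ _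
ℚ-ring = fromCommutativeRing ℚP.+-*-commutativeRing (λ x → dec⇒maybe (0ℚ ℚP.≟ x))

inv-inverseˡ : ∀ x (nz : x ≢ 0ℚ) → inv x nz * x ≡ 1ℚ
inv-inverseˡ x nz = ℚP.*-inverseˡ x {{≢-nonZero nz}}

inv-inverseʳ : ∀ x (nz : x ≢ 0ℚ) → x * inv x nz ≡ 1ℚ
inv-inverseʳ x nz = ℚP.*-inverseʳ x {{≢-nonZero nz}}

*-cancelˡ-≡ : ∀ x {a b} → x ≢ 0ℚ → x * a ≡ x * b → a ≡ b
*-cancelˡ-≡ x {a} {b} nz xa≡xb = begin
  a                   ≡⟨ ℚP.*-identityˡ a ⟨
  1ℚ * a              ≡⟨ cong (_* a) (inv-inverseˡ x nz) ⟨
  (inv x nz * x) * a  ≡⟨ ℚP.*-assoc (inv x nz) x a ⟩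
  inv x nz * (x * a)  ≡⟨ cong (inv x nz *_) xa≡xb ⟩
  inv x nz * (x * b)  ≡⟨ ℚP.*-assoc (inv x nz) x b ⟨
  (inv x nz * x) * b  ≡⟨ cong (_* b) (inv-inverseˡ x nz) ⟩
  1ℚ * b              ≡⟨ ℚP.*-identityˡ b ⟩
  b                   ∎
  where open ≡-Reasoning

x*y≡0⇒y≡0 : ∀ x {y} → x ≢ 0ℚ → x * y ≡ 0ℚ → y ≡ 0ℚ
x*y≡0⇒y≡0 x nz xy≡0 = *-cancelˡ-≡ x nz (trans xy≡0 (sym (ℚP.*-zeroʳ x)))

x*y≡1⇒x≢0 : ∀ x y → x * y ≡ 1ℚ → x ≢ 0ℚ
x*y≡1⇒x≢0 x y xy≡1 refl = ℚP.1≢0 (trans (sym xy≡1) (ℚP.*-zeroˡ y))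

inv-unique : ∀ x {y} (nz : x ≢ 0ℚ) → x * y ≡ 1ℚ → inv x nz ≡ y
inv-unique x nz xy≡1 = *-cancelˡ-≡ x nz (trans (inv-inverseʳ x nz) (sym xy≡1))

inv-≢0 : ∀ x (nz : x ≢ 0ℚ) → inv x nz ≢ 0ℚ
inv-≢0 x nz = x*y≡1⇒x≢0 (inv x nz) x (inv-inverseˡ x nz)

inv-involutive : ∀ x (nz : x ≢ 0ℚ) → inv (inv x nz) (inv-≢0 x nz) ≡ x
inv-involutive x nz = inv-unique (inv x nz) (inv-≢0 x nz) (inv-inverseˡ x nz)

pos⇒≢0 : ∀ x → Positive x → x ≢ 0ℚ
pos⇒≢0 _ () refl

neg-≢0 : ∀ {x} → x ≢ 0ℚ → - x ≢ 0ℚ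
neg-≢0 nz -x≡0 = nz (ℚP.neg-injective -x≡0)

inv-neg : ∀ x (nz : x ≢ 0ℚ) → inv (- x) (neg-≢0 nz) ≡ - inv x nz
inv-neg x nz = inv-unique (- x) (neg-≢0 nz) (trans (neg*neg x (inv x nz)) (inv-inverseʳ x nz))
  where
  neg*neg : ∀ a b → (- a) * (- b) ≡ a * b
  neg*neg = solve-∀ ℚ-ring

pow-distrib-* : ∀ x y n → pow (x * y) n ≡ pow x n * pow y n
pow-distrib-* x y zero    = refl
pow-distrib-* x y (suc n) = trans (cong ((x * y) *_) (pow-distrib-* x y n)) (interchange x y (pow x n) (pow y n))
  where
  interchange : ∀ a b c d → (a * b) * (c * d) ≡ (a * c) * (b * d)
  interchange = solve-∀ ℚ-ring

pow-1 : ∀ n → pow 1ℚ n ≡ 1ℚ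
pow-1 zero    = refl
pow-1 (suc n) = trans (ℚP.*-identityˡ (pow 1ℚ n)) (pow-1 n)

pow-inverse : ∀ x (nz : x ≢ 0ℚ) n → pow x n * pow (inv x nz) n ≡ 1ℚ
pow-inverse x nz n =
  trans (sym (pow-distrib-* x (inv x nz) n)) (trans (cong (λ t → pow t n) (inv-inverseʳ x nz)) (pow-1 n))

pow-neg : ∀ x n → n % 2 ≡ 0 → pow (- x) n ≡ pow x n
pow-neg x zero          _       = refl
pow-neg x (suc (suc n)) n-even  =
  trans (cong (λ t → (- x) * ((- x) * t)) (pow-neg x n n-even)) (neg*neg x (pow x n))
  where
  neg*neg : ∀ a t → (- a) * ((- a) * t) ≡ a * (a * t)
  neg*neg = solve-∀ ℚ-ring

suc-odd⇒even : ∀ n → suc n % 2 ≡ 1 → n % 2 ≡ 0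
suc-odd⇒even zero          _  = refl
suc-odd⇒even (suc (suc n)) odd = suc-odd⇒even n odd

sum1-cong : ∀ K {f g : ℕ → ℚ} → (∀ n → f n ≡ g n) → sum1 K f ≡ sum1 K g
sum1-cong zero    f≗g = refl
sum1-cong (suc K) f≗g = cong₂ _+_ (sum1-cong K f≗g) (f≗g (suc K))

even-poly-neg : ∀ K (c : ℕ → ℚ) x →
  sum1 K (λ n → c (2 ℕ.* n) * pow (- x) (2 ℕ.* n)) ≡ sum1 K (λ n → c (2 ℕ.* n) * pow x (2 ℕ.* n))
even-poly-neg K c x = sum1-cong K λ n → cong (c (2 ℕ.* n) *_) (pow-neg x (2 ℕ.* n) (2n-even n))
  where
  2n-even : ∀ n → (2 ℕ.* n) % 2 ≡ 0
  2n-even n = trans (cong (_% 2) (ℕP.*-comm 2 n)) (m*n%n≡0 n 2)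

fromℕ : ℕ → ℚ
fromℕ n = mkℚ (ℤ.+ n) 0 (Coprime.sym (Coprime.1-coprimeTo n))

fromℕ-suc : ∀ n → fromℕ (suc n) ≡ 1ℚ + fromℕ n
fromℕ-suc n = ℚP.toℚᵘ-injective (ℚᵘP.≃-trans (ℚᵘ.*≡* eq) (ℚᵘP.≃-sym (ℚP.toℚᵘ-homo-+ 1ℚ (fromℕ n))))
  where
  eq : ℤ.+ suc n ℤ.* ℤ.+ 1 ≡ ((ℤ.+ 1) ℤ.* (ℤ.+ 1) ℤ.+ (ℤ.+ n) ℤ.* (ℤ.+ 1)) ℤ.* (ℤ.+ 1)
  eq = trans (ℤP.*-identityʳ _) (sym (trans (ℤP.*-identityʳ _) (cong (ℤ._+_ (ℤ.+ 1)) (ℤP.*-identityʳ (ℤ.+ n)))))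

fromℕ-+ : ∀ a b → fromℕ (a ℕ.+ b) ≡ fromℕ a + fromℕ b
fromℕ-+ zero    b = sym (ℚP.+-identityˡ (fromℕ b))
fromℕ-+ (suc a) b = begin
  fromℕ (suc (a ℕ.+ b))       ≡⟨ fromℕ-suc (a ℕ.+ b) ⟩
  1ℚ + fromℕ (a ℕ.+ b)        ≡⟨ cong (1ℚ +_) (fromℕ-+ a b) ⟩
  1ℚ + (fromℕ a + fromℕ b)    ≡⟨ ℚP.+-assoc 1ℚ (fromℕ a) (fromℕ b) ⟨
  (1ℚ + fromℕ a) + fromℕ b    ≡⟨ cong (_+ fromℕ b) (fromℕ-suc a) ⟨
  fromℕ (suc a) + fromℕ b     ∎
  where open ≡-Reasoning

fromℕ-* : ∀ a b → fromℕ (a ℕ.* b) ≡ fromℕ a * fromℕ b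
fromℕ-* zero    b = sym (ℚP.*-zeroˡ (fromℕ b))
fromℕ-* (suc a) b = begin
  fromℕ (b ℕ.+ a ℕ.* b)        ≡⟨ fromℕ-+ b (a ℕ.* b) ⟩
  fromℕ b + fromℕ (a ℕ.* b)    ≡⟨ cong (fromℕ b +_) (fromℕ-* a b) ⟩
  fromℕ b + fromℕ a * fromℕ b  ≡⟨ distrib (fromℕ a) (fromℕ b) ⟩
  (1ℚ + fromℕ a) * fromℕ b     ≡⟨ cong (_* fromℕ b) (fromℕ-suc a) ⟨
  fromℕ (suc a) * fromℕ b      ∎
  where
  open ≡-Reasoning
  distrib : ∀ a b → b + a * b ≡ (1ℚ + a) * b
  distrib = solve-∀ ℚ-ring

fromℕ-injective : ∀ {a b} → fromℕ a ≡ fromℕ b → a ≡ b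
fromℕ-injective eq = ℤP.+-injective (cong ℚ.numerator eq)

pow-fromℕ : ∀ m k → pow (fromℕ m) k ≡ fromℕ (m ℕ.^ k)
pow-fromℕ m zero    = refl
pow-fromℕ m (suc k) = trans (cong (fromℕ m *_) (pow-fromℕ m k)) (sym (fromℕ-* m (m ℕ.^ k)))

pow-2-≢-1 : ∀ k → pow (1ℚ + 1ℚ) (suc k) ≢ 1ℚ
pow-2-≢-1 k 2^[1+k]≡1 = ℕP.even≢odd (2 ℕ.^ k) 0 (fromℕ-injective (trans (sym (pow-fromℕ 2 (suc k))) 2^[1+k]≡1))

fromℕ-suc-≢0 : ∀ n → fromℕ (suc n) ≢ 0ℚ
fromℕ-suc-≢0 n ()

mkℚ-numerator-denominator : ∀ n d .(c : Coprime.Coprime n (suc d)) → mkℚ (ℤ.+ n) d c * fromℕ (suc d) ≡ fromℕ n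
mkℚ-numerator-denominator n d c =
  ℚP.toℚᵘ-injective (ℚᵘP.≃-trans (ℚP.toℚᵘ-homo-* (mkℚ (ℤ.+ n) d c) (fromℕ (suc d))) (ℚᵘ.*≡* eq))
  where
  eq : (ℤ.+ n ℤ.* ℤ.+ suc d) ℤ.* ℤ.+ 1 ≡ ℤ.+ n ℤ.* ℤ.+ (suc d ℕ.* 1)
  eq = trans (ℤP.*-identityʳ _) (cong (λ k → ℤ.+ n ℤ.* ℤ.+ k) (sym (ℕP.*-identityʳ (suc d))))

-- ratio m n = (m + 1) / (n + 1). It is opaque because unfolding ℚ arithmetic on open terms
-- (e.g. during with-abstraction) makes type checking blow up.
opaque
  ratio : ℕ → ℕ → ℚ
  ratio m n = fromℕ (suc m) * inv (fromℕ (suc n)) (fromℕ-suc-≢0 n)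

  ratio-def : ∀ m n → ratio m n ≡ fromℕ (suc m) * inv (fromℕ (suc n)) (fromℕ-suc-≢0 n)
  ratio-def m n = refl

ratio-*-ratio : ∀ m n → ratio m n * ratio n m ≡ 1ℚ
ratio-*-ratio m n = begin
  ratio m n * ratio n m  ≡⟨ cong₂ _*_ (ratio-def m n) (ratio-def n m) ⟩
  (a * i) * (b * j)      ≡⟨ interchange a i b j ⟩
  (a * j) * (b * i)      ≡⟨ cong₂ _*_ (inv-inverseʳ a (fromℕ-suc-≢0 m)) (inv-inverseʳ b (fromℕ-suc-≢0 n)) ⟩
  1ℚ * 1ℚ                ≡⟨ ℚP.*-identityˡ 1ℚ ⟩
  1ℚ                     ∎
  where
  open ≡-Reasoning
  a = fromℕ (suc m)
  b = fromℕ (suc n)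
  i = inv b (fromℕ-suc-≢0 n)
  j = inv a (fromℕ-suc-≢0 m)
  interchange : ∀ a i b j → (a * i) * (b * j) ≡ (a * j) * (b * i)
  interchange = solve-∀ ℚ-ring

ratio-≢0 : ∀ m n → ratio m n ≢ 0ℚ
ratio-≢0 m n = x*y≡1⇒x≢0 (ratio m n) (ratio n m) (ratio-*-ratio m n)

inv-ratio : ∀ m n → inv (ratio m n) (ratio-≢0 m n) ≡ ratio n m
inv-ratio m n = inv-unique (ratio m n) (ratio-≢0 m n) (ratio-*-ratio m n)

ratio-diag : ∀ n → ratio n n ≡ 1ℚ
ratio-diag n = trans (ratio-def n n) (inv-inverseʳ (fromℕ (suc n)) (fromℕ-suc-≢0 n))

ratio-suc : ∀ n k → ratio (suc n ℕ.+ k) n ≡ ratio k n + 1ℚ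
ratio-suc n k = begin
  ratio (suc n ℕ.+ k) n                  ≡⟨ ratio-def (suc n ℕ.+ k) n ⟩
  fromℕ (suc (suc n ℕ.+ k)) * i          ≡⟨ cong (λ t → fromℕ t * i) (ℕP.+-suc (suc n) k) ⟨
  fromℕ (suc n ℕ.+ suc k) * i            ≡⟨ cong (_* i) (fromℕ-+ (suc n) (suc k)) ⟩
  (fromℕ (suc n) + fromℕ (suc k)) * i    ≡⟨ ℚP.*-distribʳ-+ i (fromℕ (suc n)) (fromℕ (suc k)) ⟩
  fromℕ (suc n) * i + fromℕ (suc k) * i  ≡⟨ cong₂ _+_ (ratio-def n n) (ratio-def k n) ⟨
  ratio n n + ratio k n                  ≡⟨ cong (_+ ratio k n) (ratio-diag n) ⟩
  1ℚ + ratio k n                         ≡⟨ ℚP.+-comm 1ℚ (ratio k n) ⟩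
  ratio k n + 1ℚ                         ∎
  where
  open ≡-Reasoning
  i = inv (fromℕ (suc n)) (fromℕ-suc-≢0 n)

ratio-double : ∀ k → ratio (suc k ℕ.+ k) k ≡ 1ℚ + 1ℚ
ratio-double k = trans (ratio-suc k k) (cong (_+ 1ℚ) (ratio-diag k))

mkℚ-pos≡ratio : ∀ m n .(c : Coprime.Coprime (suc m) (suc n)) → mkℚ (ℤ.+ suc m) n c ≡ ratio m n
mkℚ-pos≡ratio m n c = begin
  x              ≡⟨ ℚP.*-identityʳ x ⟨
  x * 1ℚ         ≡⟨ cong (x *_) (inv-inverseʳ b (fromℕ-suc-≢0 n)) ⟨
  x * (b * i)    ≡⟨ ℚP.*-assoc x b i ⟨
  (x * b) * i    ≡⟨ cong (_* i) (mkℚ-numerator-denominator (suc m) n c) ⟩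
  fromℕ (suc m) * i  ≡⟨ ratio-def m n ⟨
  ratio m n      ∎
  where
  open ≡-Reasoning
  x = mkℚ (ℤ.+ suc m) n c
  b = fromℕ (suc n)
  i = inv b (fromℕ-suc-≢0 n)

module _ {ℓ} (Q : ℚ → Set ℓ) (Q-2 : Q (1ℚ + 1ℚ))
  (Q-suc : ∀ k n → Q (ratio k n) → Q (ratio (suc n ℕ.+ k) n))
  (Q-flip : ∀ m n → Q (ratio n m) → Q (ratio m n))
  where

  -- Euclid's algorithm by subtraction on (k + 1, n + 1); the measure n + k decreases.
  private
    ratio-induction-above : ∀ n k → Acc ℕ._<_ (n ℕ.+ k) → Q (ratio (suc n ℕ.+ k) n)
    ratio-induction-above n k (acc rs) with ℕP.<-cmp k n
    ... | tri≈ _ refl _ = subst Q (sym (ratio-double k)) Q-2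
    ... | tri> _ _ n<k with ℕP.m≤n⇒∃[o]m+o≡n n<k
    ...   | o , refl = Q-suc k n (ratio-induction-above n o (rs (ℕP.+-monoʳ-< n (s≤s (ℕP.m≤n+m o n)))))
    ratio-induction-above n k (acc rs) | tri< k<n _ _ with ℕP.m≤n⇒∃[o]m+o≡n k<n
    ...   | o , refl = Q-suc k n (Q-flip k n (ratio-induction-above k o (rs (s≤s (ℕP.m≤m+n (k ℕ.+ o) k)))))

  ratio-induction : ∀ m n → m ≢ n → Q (ratio m n)
  ratio-induction m n m≢n with ℕP.<-cmp m n
  ... | tri≈ _ m≡n _ = ⊥-elim (m≢n m≡n)
  ... | tri< m<n _ _ with ℕP.m≤n⇒∃[o]m+o≡n m<n
  ...   | o , refl = Q-flip m n (ratio-induction-above m o (<-wellFounded _))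
  ratio-induction m n m≢n | tri> _ _ n<m with ℕP.m≤n⇒∃[o]m+o≡n n<m
  ...   | o , refl = ratio-induction-above n o (<-wellFounded _)

-- Continuity of polynomials at 0

‖_‖₁ : Poly → ℚ
‖ []    ‖₁ = 0ℚ
‖ a ∷ p ‖₁ = ∣ a ∣ + ‖ p ‖₁

‖‖₁-nonNeg : ∀ p → NonNegative ‖ p ‖₁
‖‖₁-nonNeg []      = _
‖‖₁-nonNeg (a ∷ p) = ℚP.nonNeg+nonNeg⇒nonNeg ∣ a ∣ {{ℚP.∣-∣-nonNeg a}} ‖ p ‖₁ {{‖‖₁-nonNeg p}}

∣eval∣≤‖‖₁ : ∀ p {y} → ∣ y ∣ ≤ℚ 1ℚ → ∣ eval p y ∣ ≤ℚ ‖ p ‖₁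
∣eval∣≤‖‖₁ []      _      = ℚP.≤-refl
∣eval∣≤‖‖₁ (a ∷ p) {y} ∣y∣≤1 = begin
  ∣ a + y * eval p y ∣          ≤⟨ ℚP.∣p+q∣≤∣p∣+∣q∣ a (y * eval p y) ⟩
  ∣ a ∣ + ∣ y * eval p y ∣      ≡⟨ cong (∣ a ∣ +_) (ℚP.∣p*q∣≡∣p∣*∣q∣ y (eval p y)) ⟩
  ∣ a ∣ + ∣ y ∣ * ∣ eval p y ∣  ≤⟨ ℚP.+-monoʳ-≤ ∣ a ∣ (ℚP.*-monoˡ-≤-nonNeg ∣ y ∣ {{ℚP.∣-∣-nonNeg y}} (∣eval∣≤‖‖₁ p ∣y∣≤1)) ⟩
  ∣ a ∣ + ∣ y ∣ * ‖ p ‖₁         ≤⟨ ℚP.+-monoʳ-≤ ∣ a ∣ (ℚP.*-monoʳ-≤-nonNeg ‖ p ‖₁ {{‖‖₁-nonNeg p}} ∣y∣≤1) ⟩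
  ∣ a ∣ + 1ℚ * ‖ p ‖₁            ≡⟨ cong (∣ a ∣ +_) (ℚP.*-identityˡ ‖ p ‖₁) ⟩
  ∣ a ∣ + ‖ p ‖₁                 ∎
  where open ℚP.≤-Reasoning

-- Take y = ∣ t ∣ / (∣ t ∣ + B): then y ≤ 1 and y * B < y * (∣ t ∣ + B) = ∣ t ∣ unless t = 0.
bounded-by-small-multiples⇒≡0 : ∀ t B → NonNegative B →
  (∀ y → Positive y → y ≤ℚ 1ℚ → ∣ t ∣ ≤ℚ y * B) → t ≡ 0ℚ
bounded-by-small-multiples⇒≡0 t B B≥0 bound with t ℚP.≟ 0ℚ
... | yes t≡0 = t≡0
... | no  t≢0 = ⊥-elim (ℚP.<-irrefl refl (begin-strict
  u      ≤⟨ bound y y>0 y≤1 ⟩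
  y * B  <⟨ ℚP.*-monoʳ-<-pos y {{y>0}} B<M ⟩
  y * M  ≡⟨ yM≡u ⟩
  u      ∎))
  where
  open ℚP.≤-Reasoning
  u = ∣ t ∣
  instance
    u>0 : Positive u
    u>0 = ℚP.nonNeg∧nonZero⇒pos u {{ℚP.∣-∣-nonNeg t}} {{≢-nonZero (λ u≡0 → t≢0 (ℚP.∣p∣≡0⇒p≡0 t u≡0))}}
  M = u + B
  instance
    M>0 : Positive M
    M>0 = ℚP.pos+nonNeg⇒pos u B {{B≥0}}
    M≢0 : NonZero M
    M≢0 = ℚP.pos⇒nonZero M
  y = u * 1/ M
  y>0 : Positive y
  y>0 = ℚP.pos*pos⇒pos u (1/ M) {{ℚP.1/pos⇒pos M}}
  yM≡u : y * M ≡ u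
  yM≡u = trans (ℚP.*-assoc u (1/ M) M) (trans (cong (u *_) (ℚP.*-inverseˡ M)) (ℚP.*-identityʳ u))
  u≤M : u ≤ℚ M
  u≤M = ℚP.≤-trans (ℚP.≤-reflexive (sym (ℚP.+-identityʳ u))) (ℚP.+-monoʳ-≤ u (ℚP.nonNegative⁻¹ B {{B≥0}}))
  B<M : B <ℚ M
  B<M = ℚP.≤-<-trans (ℚP.≤-reflexive (sym (ℚP.+-identityˡ B))) (ℚP.+-monoˡ-< B (ℚP.positive⁻¹ u))
  y≤1 : y ≤ℚ 1ℚ
  y≤1 = ℚP.*-cancelʳ-≤-pos M (ℚP.≤-trans (ℚP.≤-reflexive yM≡u) (ℚP.≤-trans u≤M (ℚP.≤-reflexive (sym (ℚP.*-identityˡ M)))))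

eval-odd⇒eval-0≡0 : ∀ p → (∀ y → y ≢ 0ℚ → eval p (- y) ≡ - eval p y) → eval p 0ℚ ≡ 0ℚ
eval-odd⇒eval-0≡0 []      _   = refl
eval-odd⇒eval-0≡0 (a ∷ q) odd = trans (cong (_+ 0ℚ * eval q 0ℚ) a≡0) (0+0*t≡0 (eval q 0ℚ))
  where
  S = ‖ q ‖₁
  Δ : ℚ → ℚ
  Δ y = eval q (- y) - eval q y
  0+0*t≡0 : ∀ t → 0ℚ + 0ℚ * t ≡ 0ℚ
  0+0*t≡0 = solve-∀ ℚ-ring
  2a≡yΔ : ∀ y → y ≢ 0ℚ → a + a ≡ y * Δ y
  2a≡yΔ y nz = trans (regroup a y (eval q (- y)) (eval q y))
    (trans (cong (y * Δ y +_) (x≈y⇒x∙y⁻¹≈ε (odd y nz))) (ℚP.+-identityʳ (y * Δ y)))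
    where
    regroup : ∀ a y u v → a + a ≡ y * (u - v) + ((a + (- y) * u) - - (a + y * v))
    regroup = solve-∀ ℚ-ring
  ∣Δ∣≤2S : ∀ y → ∣ y ∣ ≤ℚ 1ℚ → ∣ Δ y ∣ ≤ℚ S + S
  ∣Δ∣≤2S y ∣y∣≤1 = ℚP.≤-trans (ℚP.∣p-q∣≤∣p∣+∣q∣ (eval q (- y)) (eval q y))
    (ℚP.+-mono-≤ (∣eval∣≤‖‖₁ q (ℚP.≤-trans (ℚP.≤-reflexive (ℚP.∣-p∣≡∣p∣ y)) ∣y∣≤1)) (∣eval∣≤‖‖₁ q ∣y∣≤1))
  bound : ∀ y → Positive y → y ≤ℚ 1ℚ → ∣ a + a ∣ ≤ℚ y * (S + S)
  bound y y>0 y≤1 = begin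
    ∣ a + a ∣         ≡⟨ cong ∣_∣ (2a≡yΔ y (pos⇒≢0 y y>0)) ⟩
    ∣ y * Δ y ∣       ≡⟨ ℚP.∣p*q∣≡∣p∣*∣q∣ y (Δ y) ⟩
    ∣ y ∣ * ∣ Δ y ∣   ≡⟨ cong (_* ∣ Δ y ∣) ∣y∣≡y ⟩
    y * ∣ Δ y ∣       ≤⟨ ℚP.*-monoˡ-≤-nonNeg y {{ℚP.pos⇒nonNeg y {{y>0}}}} (∣Δ∣≤2S y (ℚP.≤-trans (ℚP.≤-reflexive ∣y∣≡y) y≤1)) ⟩
    y * (S + S)       ∎
    where
    open ℚP.≤-Reasoning
    ∣y∣≡y : ∣ y ∣ ≡ y
    ∣y∣≡y = ℚP.0≤p⇒∣p∣≡p (ℚP.<⇒≤ (ℚP.positive⁻¹ y {{y>0}}))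
  a≡0 : a ≡ 0ℚ
  a≡0 = trans (halve a) (trans (cong (½ *_) (bounded-by-small-multiples⇒≡0 (a + a) (S + S) S+S≥0 bound)) (ℚP.*-zeroʳ ½))
    where
    halve : ∀ a → a ≡ ½ * (a + a)
    halve = solve-∀ ℚ-ring
    S+S≥0 = ℚP.nonNeg+nonNeg⇒nonNeg S {{‖‖₁-nonNeg q}} S {{‖‖₁-nonNeg q}}

-- 4 (e - 1) c = 2e E₃ - E₁ - E₂, where Eᵢ = 0 is the i-th hypothesis written as lhs - rhs = 0.
three-equations⇒c≡0 : ∀ e t a b c → e ≢ 1ℚ →
  (1ℚ + 1ℚ) * (e * a) ≡ (1ℚ - 1ℚ) * t - (c + c) →
  (- (1ℚ + 1ℚ) + 1ℚ) * (e * a) ≡ (- (1ℚ + 1ℚ) - 1ℚ) * (e * b) - (c + c) →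
  (½ + 1ℚ) * b ≡ (½ - 1ℚ) * a - (c + c) →
  c ≡ 0ℚ
three-equations⇒c≡0 e t a b c e≢1 h₁ h₂ h₃ =
  x*y≡0⇒y≡0 (e - 1ℚ) (λ e-1≡0 → e≢1 (x∙y⁻¹≈ε⇒x≈y e 1ℚ e-1≡0))
    (x*y≡0⇒y≡0 (1ℚ + 1ℚ + 1ℚ + 1ℚ) (λ ())
      (trans (combination e t a b c) (vanish (x≈y⇒x∙y⁻¹≈ε h₁) (x≈y⇒x∙y⁻¹≈ε h₂) (x≈y⇒x∙y⁻¹≈ε h₃))))
  where
  combination : ∀ e t a b c → (1ℚ + 1ℚ + 1ℚ + 1ℚ) * ((e - 1ℚ) * c) ≡
    (e + e) * ((½ + 1ℚ) * b - ((½ - 1ℚ) * a - (c + c)))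
      - ((1ℚ + 1ℚ) * (e * a) - ((1ℚ - 1ℚ) * t - (c + c)))
      - ((- (1ℚ + 1ℚ) + 1ℚ) * (e * a) - ((- (1ℚ + 1ℚ) - 1ℚ) * (e * b) - (c + c)))
  combination = solve-∀ ℚ-ring
  vanish : ∀ {d₁ d₂ d₃} → d₁ ≡ 0ℚ → d₂ ≡ 0ℚ → d₃ ≡ 0ℚ → (e + e) * d₃ - d₁ - d₂ ≡ 0ℚ
  vanish refl refl refl = cong (λ t → t - 0ℚ - 0ℚ) (ℚP.*-zeroʳ (e + e))

module ThreeTermRelation
  (w : ℕ) (w-even : w % 2 ≡ 0) (2^w≢1 : pow (1ℚ + 1ℚ) w ≢ 1ℚ)
  (P C O : ℚ → ℚ) (c₀ : ℚ)
  (C≡x*P : ∀ x → C x ≡ x * P x)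
  (C-even : ∀ x → C (- x) ≡ C x)
  (P-reciprocal : ∀ x (nz : x ≢ 0ℚ) → P x ≡ pow x w * P (inv x nz))
  (O-odd : ∀ x → O (- x) ≡ - O x)
  (C-relation : ∀ x (nz : x ≢ 0ℚ) →
    (C x - C (1ℚ + x)) - pow x (suc w) * C (1ℚ + inv x nz) ≡ c₀ + O x)
  where

  pow-w-neg : ∀ x → pow (- x) w ≡ pow x w
  pow-w-neg x = pow-neg x w w-even

  P-odd : ∀ y → y ≢ 0ℚ → P (- y) ≡ - P y
  P-odd y nz = *-cancelˡ-≡ y nz (begin
    y * P (- y)          ≡⟨ neg-swap y (P (- y)) ⟩
    - ((- y) * P (- y))  ≡⟨ cong -_ (C≡x*P (- y)) ⟨
    - C (- y)            ≡⟨ cong -_ (C-even y) ⟩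
    - C y                ≡⟨ cong -_ (C≡x*P y) ⟩
    - (y * P y)          ≡⟨ ℚP.neg-distribʳ-* y (P y) ⟩
    y * (- P y)          ∎)
    where
    open ≡-Reasoning
    neg-swap : ∀ a b → a * b ≡ - ((- a) * b)
    neg-swap = solve-∀ ℚ-ring

  P-reciprocal-neg : ∀ x (nz : x ≢ 0ℚ) → pow x w * P (- inv x nz) ≡ P (- x)
  P-reciprocal-neg x nz = begin
    pow x w * P (- inv x nz)    ≡⟨ cong (pow x w *_) (P-odd (inv x nz) (inv-≢0 x nz)) ⟩
    pow x w * (- P (inv x nz))  ≡⟨ ℚP.neg-distribʳ-* (pow x w) (P (inv x nz)) ⟨
    - (pow x w * P (inv x nz))  ≡⟨ cong -_ (P-reciprocal x nz) ⟨
    - P x                       ≡⟨ P-odd x nz ⟨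
    P (- x)                     ∎
    where open ≡-Reasoning

  two-term-relation : ∀ x (nz : x ≢ 0ℚ) → P x + pow x w * P (- inv x nz) ≡ 0ℚ
  two-term-relation x nz = begin
    P x + pow x w * P (- inv x nz)  ≡⟨ cong (P x +_) (P-reciprocal-neg x nz) ⟩
    P x + P (- x)                   ≡⟨ cong (P x +_) (P-odd x nz) ⟩
    P x - P x                       ≡⟨ ℚP.+-inverseʳ (P x) ⟩
    0ℚ                              ∎
    where open ≡-Reasoning

  T : (x : ℚ) → .(x ≢ 0ℚ) → ℚ
  T x nz = P x + P (1ℚ - x) + pow x w * P (1ℚ - (1/ x) {{≢-nonZero nz}})

  T-cong : ∀ {x y} (nx : x ≢ 0ℚ) (ny : y ≢ 0ℚ) → x ≡ y → T x nx ≡ T y ny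
  T-cong _ _ refl = refl

  three-term≡T : ∀ x (nz : x ≢ 0ℚ) (nz₁ : x - 1ℚ ≢ 0ℚ) →
    (P x + pow x w * P (1ℚ - inv x nz)) + pow (x - 1ℚ) w * P (- inv (x - 1ℚ) nz₁) ≡ T x nz
  three-term≡T x nz nz₁ = begin
    (P x + pow x w * P (1ℚ - inv x nz)) + pow (x - 1ℚ) w * P (- inv (x - 1ℚ) nz₁)
      ≡⟨ cong ((P x + pow x w * P (1ℚ - inv x nz)) +_) (P-reciprocal-neg (x - 1ℚ) nz₁) ⟩
    (P x + pow x w * P (1ℚ - inv x nz)) + P (- (x - 1ℚ))
      ≡⟨ cong (λ t → (P x + pow x w * P (1ℚ - inv x nz)) + P t) (neg-[x-1] x) ⟩
    (P x + pow x w * P (1ℚ - inv x nz)) + P (1ℚ - x)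
      ≡⟨ swap (P x) (pow x w * P (1ℚ - inv x nz)) (P (1ℚ - x)) ⟩
    T x nz ∎
    where
    open ≡-Reasoning
    neg-[x-1] : ∀ x → - (x - 1ℚ) ≡ 1ℚ - x
    neg-[x-1] = solve-∀ ℚ-ring
    swap : ∀ a b c → (a + b) + c ≡ a + c + b
    swap = solve-∀ ℚ-ring

  T-inv : ∀ x (nz : x ≢ 0ℚ) → T x nz ≡ pow x w * T (inv x nz) (inv-≢0 x nz)
  T-inv x nz = sym (begin
    pow x w * (P i + P (1ℚ - i) + pow i w * P (1ℚ - inv i (inv-≢0 x nz)))
      ≡⟨ cong (λ t → pow x w * (P i + P (1ℚ - i) + pow i w * P (1ℚ - t))) (inv-involutive x nz) ⟩
    pow x w * (P i + P (1ℚ - i) + pow i w * P (1ℚ - x))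
      ≡⟨ distrib (pow x w) (P i) (P (1ℚ - i)) (pow i w) (P (1ℚ - x)) ⟩
    pow x w * P i + pow x w * P (1ℚ - i) + (pow x w * pow i w) * P (1ℚ - x)
      ≡⟨ cong₂ (λ a b → a + pow x w * P (1ℚ - i) + b * P (1ℚ - x)) (sym (P-reciprocal x nz)) (pow-inverse x nz w) ⟩
    P x + pow x w * P (1ℚ - i) + 1ℚ * P (1ℚ - x)
      ≡⟨ swap (P x) (pow x w * P (1ℚ - i)) (P (1ℚ - x)) ⟩
    T x nz ∎)
    where
    open ≡-Reasoning
    i = inv x nz
    distrib : ∀ a b c d e → a * (b + c + d * e) ≡ a * b + a * c + (a * d) * e
    distrib = solve-∀ ℚ-ring
    swap : ∀ a b c → a + b + 1ℚ * c ≡ a + c + b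
    swap = solve-∀ ℚ-ring

  -- With j = 1/(1 - x), the point z = 1 - j satisfies (1 - x) z = -x and 1/z = 1 - 1/x.
  T-reflect : ∀ x (nz : x ≢ 0ℚ) (nz' : 1ℚ - x ≢ 0ℚ) → T (1ℚ - x) nz' ≡ T x nz
  T-reflect x nz nz' = begin
    P (1ℚ - x) + P (1ℚ - (1ℚ - x)) + pow (1ℚ - x) w * P z
      ≡⟨ cong₂ (λ u v → P (1ℚ - x) + P u + v) (1-[1-x] x) last-term ⟩
    P (1ℚ - x) + P x + pow x w * P (1ℚ - i)
      ≡⟨ swap (P (1ℚ - x)) (P x) (pow x w * P (1ℚ - i)) ⟩
    T x nz ∎
    where
    open ≡-Reasoning
    i = inv x nz
    j = inv (1ℚ - x) nz'
    z = 1ℚ - j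
    1-[1-x] : ∀ x → 1ℚ - (1ℚ - x) ≡ x
    1-[1-x] = solve-∀ ℚ-ring
    swap : ∀ a b c → a + b + c ≡ b + a + c
    swap = solve-∀ ℚ-ring
    z*[1-i]-expand : ∀ x i j → (1ℚ - j) * (1ℚ - i) ≡ 1ℚ + (i * ((1ℚ - x) * j - 1ℚ) + j * (x * i - 1ℚ))
    z*[1-i]-expand = solve-∀ ℚ-ring
    [1-x]*z-expand : ∀ x j → (1ℚ - x) * (1ℚ - j) ≡ - x + (1ℚ - (1ℚ - x) * j)
    [1-x]*z-expand = solve-∀ ℚ-ring
    z*[1-i]≡1 : z * (1ℚ - i) ≡ 1ℚ
    z*[1-i]≡1 = begin
      z * (1ℚ - i)                                               ≡⟨ z*[1-i]-expand x i j ⟩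
      1ℚ + (i * ((1ℚ - x) * j - 1ℚ) + j * (x * i - 1ℚ))          ≡⟨ cong₂ (λ u v → 1ℚ + (i * u + j * v))
                                                                      (x≈y⇒x∙y⁻¹≈ε (inv-inverseʳ (1ℚ - x) nz'))
                                                                      (x≈y⇒x∙y⁻¹≈ε (inv-inverseʳ x nz)) ⟩
      1ℚ + (i * 0ℚ + j * 0ℚ)                                     ≡⟨ cong₂ (λ u v → 1ℚ + (u + v)) (ℚP.*-zeroʳ i) (ℚP.*-zeroʳ j) ⟩
      1ℚ                                                         ∎
    nz-z : z ≢ 0ℚ
    nz-z = x*y≡1⇒x≢0 z (1ℚ - i) z*[1-i]≡1
    [1-x]*z≡-x : (1ℚ - x) * z ≡ - x
    [1-x]*z≡-x = begin
      (1ℚ - x) * z                ≡⟨ [1-x]*z-expand x j ⟩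
      - x + (1ℚ - (1ℚ - x) * j)   ≡⟨ cong (λ t → - x + (1ℚ - t)) (inv-inverseʳ (1ℚ - x) nz') ⟩
      - x + (1ℚ - 1ℚ)             ≡⟨ ℚP.+-identityʳ (- x) ⟩
      - x                         ∎
    last-term : pow (1ℚ - x) w * P z ≡ pow x w * P (1ℚ - i)
    last-term = begin
      pow (1ℚ - x) w * P z                          ≡⟨ cong (pow (1ℚ - x) w *_) (P-reciprocal z nz-z) ⟩
      pow (1ℚ - x) w * (pow z w * P (inv z nz-z))   ≡⟨ cong (λ t → pow (1ℚ - x) w * (pow z w * P t)) (inv-unique z nz-z z*[1-i]≡1) ⟩
      pow (1ℚ - x) w * (pow z w * P (1ℚ - i))       ≡⟨ ℚP.*-assoc (pow (1ℚ - x) w) (pow z w) (P (1ℚ - i)) ⟨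
      (pow (1ℚ - x) w * pow z w) * P (1ℚ - i)       ≡⟨ cong (_* P (1ℚ - i)) (pow-distrib-* (1ℚ - x) z w) ⟨
      pow ((1ℚ - x) * z) w * P (1ℚ - i)             ≡⟨ cong (λ t → pow t w * P (1ℚ - i)) [1-x]*z≡-x ⟩
      pow (- x) w * P (1ℚ - i)                      ≡⟨ cong (_* P (1ℚ - i)) (pow-w-neg x) ⟩
      pow x w * P (1ℚ - i)                          ∎

  T-neg : ∀ x (nz : x ≢ 0ℚ) → T (- x) (neg-≢0 nz) ≡ - P x + P (1ℚ + x) + pow x w * P (1ℚ + inv x nz)
  T-neg x nz = cong₂ _+_ (cong₂ _+_ (P-odd x nz) (cong P (1-[-x] x)))
    (cong₂ _*_ (pow-w-neg x) (cong P (trans (cong (λ t → 1ℚ - t) (inv-neg x nz)) (1-[-x] (inv x nz)))))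
    where
    1-[-x] : ∀ x → 1ℚ - (- x) ≡ 1ℚ + x
    1-[-x] = solve-∀ ℚ-ring

  antisymmetrized-relation : ∀ x (nz : x ≢ 0ℚ) →
    (x - 1ℚ) * T x nz - (x + 1ℚ) * T (- x) (neg-≢0 nz) ≡ c₀ + c₀
  antisymmetrized-relation x nz = begin
    (x - 1ℚ) * T x nz - (x + 1ℚ) * T (- x) (neg-≢0 nz)
      ≡⟨ cong (λ t → (x - 1ℚ) * T x nz - (x + 1ℚ) * t) (T-neg x nz) ⟩
    (x - 1ℚ) * (p + A + xʷ * D) - (x + 1ℚ) * (- p + B + xʷ * E)
      ≡⟨ regroup x i xʷ p A B D E ⟩
    (X₊ + X₋) + (x * i - 1ℚ) * (xʷ * (E + D))
      ≡⟨ cong (λ t → (X₊ + X₋) + (t - 1ℚ) * (xʷ * (E + D))) (inv-inverseʳ x nz) ⟩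
    (X₊ + X₋) + (1ℚ - 1ℚ) * (xʷ * (E + D))
      ≡⟨ drop-zero (X₊ + X₋) (xʷ * (E + D)) ⟩
    X₊ + X₋
      ≡⟨ cong₂ _+_ relation-at-x relation-at-[-x] ⟨
    ((C x - C (1ℚ + x)) - pow x (suc w) * C (1ℚ + i))
      + ((C (- x) - C (1ℚ + - x)) - pow (- x) (suc w) * C (1ℚ + inv (- x) (neg-≢0 nz)))
      ≡⟨ cong₂ _+_ (C-relation x nz) (C-relation (- x) (neg-≢0 nz)) ⟩
    (c₀ + O x) + (c₀ + O (- x))
      ≡⟨ cong (λ t → (c₀ + O x) + (c₀ + t)) (O-odd x) ⟩
    (c₀ + O x) + (c₀ + - O x)
      ≡⟨ cancel c₀ (O x) ⟩
    c₀ + c₀ ∎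
    where
    open ≡-Reasoning
    i = inv x nz
    xʷ = pow x w
    p = P x
    A = P (1ℚ - x)
    B = P (1ℚ + x)
    D = P (1ℚ - i)
    E = P (1ℚ + i)
    X₊ = (x * p - (1ℚ + x) * B) - (x * xʷ) * ((1ℚ + i) * E)
    X₋ = (x * p - (1ℚ - x) * A) - ((- x) * xʷ) * ((1ℚ - i) * D)
    relation-at-x : (C x - C (1ℚ + x)) - pow x (suc w) * C (1ℚ + i) ≡ X₊
    relation-at-x = cong₂ _-_ (cong₂ _-_ (C≡x*P x) (C≡x*P (1ℚ + x))) (cong ((x * xʷ) *_) (C≡x*P (1ℚ + i)))
    relation-at-[-x] : (C (- x) - C (1ℚ + - x)) - pow (- x) (suc w) * C (1ℚ + inv (- x) (neg-≢0 nz)) ≡ X₋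
    relation-at-[-x] = cong₂ _-_ (cong₂ _-_ (trans (C-even x) (C≡x*P x)) (C≡x*P (1ℚ + - x)))
      (cong₂ _*_ (cong ((- x) *_) (pow-w-neg x)) (trans (cong (λ t → C (1ℚ + t)) (inv-neg x nz)) (C≡x*P (1ℚ + - i))))
    regroup : ∀ x i xʷ p A B D E →
      (x - 1ℚ) * (p + A + xʷ * D) - (x + 1ℚ) * (- p + B + xʷ * E)
        ≡ (((x * p - (1ℚ + x) * B) - (x * xʷ) * ((1ℚ + i) * E)) + ((x * p - (1ℚ - x) * A) - ((- x) * xʷ) * ((1ℚ - i) * D)))
          + (x * i - 1ℚ) * (xʷ * (E + D))
    regroup = solve-∀ ℚ-ring
    drop-zero : ∀ a b → a + (1ℚ - 1ℚ) * b ≡ a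
    drop-zero = solve-∀ ℚ-ring
    cancel : ∀ c o → (c + o) + (c + - o) ≡ c + c
    cancel = solve-∀ ℚ-ring

  T-recurrence : ∀ x (nz : x ≢ 0ℚ) (nz₁ : x + 1ℚ ≢ 0ℚ) →
    (x + 1ℚ) * T (x + 1ℚ) nz₁ ≡ (x - 1ℚ) * T x nz - (c₀ + c₀)
  T-recurrence x nz nz₁ = begin
    (x + 1ℚ) * T (x + 1ℚ) nz₁                                   ≡⟨ cong ((x + 1ℚ) *_) T[x+1]≡T[-x] ⟩
    b                                                          ≡⟨ b≡a-[a-b] a b ⟩
    a - (a - b)                                                ≡⟨ cong (λ t → a - t) (antisymmetrized-relation x nz) ⟩
    a - (c₀ + c₀)                                              ∎
    where
    open ≡-Reasoning
    a = (x - 1ℚ) * T x nz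
    b = (x + 1ℚ) * T (- x) (neg-≢0 nz)
    x+1≡1-[-x] : ∀ x → x + 1ℚ ≡ 1ℚ - - x
    x+1≡1-[-x] = solve-∀ ℚ-ring
    b≡a-[a-b] : ∀ a b → b ≡ a - (a - b)
    b≡a-[a-b] = solve-∀ ℚ-ring
    nz' : 1ℚ - - x ≢ 0ℚ
    nz' e = nz₁ (trans (x+1≡1-[-x] x) e)
    T[x+1]≡T[-x] : T (x + 1ℚ) nz₁ ≡ T (- x) (neg-≢0 nz)
    T[x+1]≡T[-x] = trans (T-cong nz₁ nz' (x+1≡1-[-x] x)) (T-reflect (- x) (neg-≢0 nz) nz')

  -- The recurrence at x = 1, -2 and ½, expressed in a = T(½) and b = T(3/2) via T(2) = 2ʷ T(½),
  -- T(-1) = T(2), T(-2) = 2ʷ T(-½) and T(-½) = T(3/2).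
  c₀≡0 : c₀ ≡ 0ℚ
  c₀≡0 = three-equations⇒c≡0 e (T 1ℚ ℚP.1≢0) a b c₀ 2^w≢1 at-1 at-[-2] at-½
    where
    open ≡-Reasoning
    two = 1ℚ + 1ℚ
    e = pow two w
    a = T ½ (λ ())
    b = T (½ + 1ℚ) (λ ())
    T2≡ea : T two (λ ()) ≡ e * a
    T2≡ea = T-inv two (λ ())
    T[-2]≡eb : T (- two) (λ ()) ≡ e * b
    T[-2]≡eb = trans (T-inv (- two) (λ ())) (cong₂ _*_ (pow-w-neg two) (T-reflect (½ + 1ℚ) (λ ()) (λ ())))
    at-1 : two * (e * a) ≡ (1ℚ - 1ℚ) * T 1ℚ ℚP.1≢0 - (c₀ + c₀)
    at-1 = trans (cong (two *_) (sym T2≡ea)) (T-recurrence 1ℚ ℚP.1≢0 (λ ()))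
    at-[-2] : (- two + 1ℚ) * (e * a) ≡ (- two - 1ℚ) * (e * b) - (c₀ + c₀)
    at-[-2] = begin
      (- two + 1ℚ) * (e * a)                              ≡⟨ cong ((- two + 1ℚ) *_) (trans (sym T2≡ea) (T-reflect (- 1ℚ) (λ ()) (λ ()))) ⟩
      (- two + 1ℚ) * T (- two + 1ℚ) (λ ())                ≡⟨ T-recurrence (- two) (λ ()) (λ ()) ⟩
      (- two - 1ℚ) * T (- two) (λ ()) - (c₀ + c₀)         ≡⟨ cong (λ t → (- two - 1ℚ) * t - (c₀ + c₀)) T[-2]≡eb ⟩
      (- two - 1ℚ) * (e * b) - (c₀ + c₀)                  ∎
    at-½ : (½ + 1ℚ) * b ≡ (½ - 1ℚ) * a - (c₀ + c₀)
    at-½ = T-recurrence ½ (λ ()) (λ ())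

  T-shift : ∀ x (nz : x ≢ 0ℚ) (nz₁ : x + 1ℚ ≢ 0ℚ) → T x nz ≡ 0ℚ → T (x + 1ℚ) nz₁ ≡ 0ℚ
  T-shift x nz nz₁ Tx≡0 = x*y≡0⇒y≡0 (x + 1ℚ) nz₁ (begin
    (x + 1ℚ) * T (x + 1ℚ) nz₁      ≡⟨ T-recurrence x nz nz₁ ⟩
    (x - 1ℚ) * T x nz - (c₀ + c₀)  ≡⟨ cong₂ (λ t c → (x - 1ℚ) * t - (c + c)) Tx≡0 c₀≡0 ⟩
    (x - 1ℚ) * 0ℚ - (0ℚ + 0ℚ)      ≡⟨ vanish (x - 1ℚ) ⟩
    0ℚ                             ∎)
    where
    open ≡-Reasoning
    vanish : ∀ a → a * 0ℚ - (0ℚ + 0ℚ) ≡ 0ℚ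
    vanish = solve-∀ ℚ-ring

  T-2≡0 : T (1ℚ + 1ℚ) (λ ()) ≡ 0ℚ
  T-2≡0 = x*y≡0⇒y≡0 (1ℚ + 1ℚ) (λ ()) (begin
    (1ℚ + 1ℚ) * T (1ℚ + 1ℚ) (λ ())       ≡⟨ T-recurrence 1ℚ ℚP.1≢0 (λ ()) ⟩
    (1ℚ - 1ℚ) * T 1ℚ ℚP.1≢0 - (c₀ + c₀)  ≡⟨ cong (λ c → (1ℚ - 1ℚ) * T 1ℚ ℚP.1≢0 - (c + c)) c₀≡0 ⟩
    (1ℚ - 1ℚ) * T 1ℚ ℚP.1≢0 - (0ℚ + 0ℚ)  ≡⟨ vanish (T 1ℚ ℚP.1≢0) ⟩
    0ℚ                                   ∎)
    where
    open ≡-Reasoning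
    vanish : ∀ t → (1ℚ - 1ℚ) * t - (0ℚ + 0ℚ) ≡ 0ℚ
    vanish = solve-∀ ℚ-ring

  T-ratio : ∀ m n → m ≢ n → T (ratio m n) (ratio-≢0 m n) ≡ 0ℚ
  T-ratio m n m≢n = ratio-induction (λ x → (nz : x ≢ 0ℚ) → T x nz ≡ 0ℚ) (λ _ → T-2≡0) shift flip m n m≢n (ratio-≢0 m n)
    where
    open ≡-Reasoning
    shift : ∀ k n → ((nz : ratio k n ≢ 0ℚ) → T (ratio k n) nz ≡ 0ℚ) →
      (nz : ratio (suc n ℕ.+ k) n ≢ 0ℚ) → T (ratio (suc n ℕ.+ k) n) nz ≡ 0ℚ
    shift k n T≡0 nz = trans (T-cong nz nz₁ (ratio-suc n k)) (T-shift (ratio k n) (ratio-≢0 k n) nz₁ (T≡0 (ratio-≢0 k n)))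
      where
      nz₁ : ratio k n + 1ℚ ≢ 0ℚ
      nz₁ e = nz (trans (ratio-suc n k) e)
    flip : ∀ m n → ((nz : ratio n m ≢ 0ℚ) → T (ratio n m) nz ≡ 0ℚ) →
      (nz : ratio m n ≢ 0ℚ) → T (ratio m n) nz ≡ 0ℚ
    flip m n T≡0 nz = begin
      T (ratio m n) nz
        ≡⟨ T-inv (ratio m n) nz ⟩
      pow (ratio m n) w * T (inv (ratio m n) nz) (inv-≢0 (ratio m n) nz)
        ≡⟨ cong (pow (ratio m n) w *_) (trans (T-cong (inv-≢0 (ratio m n) nz) (ratio-≢0 n m) (inv-ratio m n)) (T≡0 (ratio-≢0 n m))) ⟩
      pow (ratio m n) w * 0ℚ
        ≡⟨ ℚP.*-zeroʳ (pow (ratio m n) w) ⟩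
      0ℚ ∎

  T-vanishes : ∀ x (nz : x ≢ 0ℚ) → x ≢ 1ℚ → T x nz ≡ 0ℚ
  T-vanishes (mkℚ (ℤ.+ zero) d c) nz _ = ⊥-elim (nz (ℚP.↥p≡0⇒p≡0 (mkℚ (ℤ.+ zero) d c) refl))
  T-vanishes (mkℚ (ℤ.+ suc m) n c) nz x≢1 =
    trans (T-cong nz (ratio-≢0 m n) x≡ratio) (T-ratio m n λ m≡n → x≢1 (trans x≡ratio (trans (cong (λ k → ratio k n) m≡n) (ratio-diag n))))
    where
    x≡ratio = mkℚ-pos≡ratio m n c
  T-vanishes x@(mkℚ ℤ.-[1+ m ] n c) nz _ =
    trans (sym (T-reflect x nz nz')) (trans (T-cong nz' (ratio-≢0 (suc n ℕ.+ m) n) 1-x≡ratio) (T-ratio (suc n ℕ.+ m) n λ e → ℕP.m≢1+m+n n (sym e)))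
    where
    1-x≡ratio : 1ℚ - x ≡ ratio (suc n ℕ.+ m) n
    1-x≡ratio = trans (cong (1ℚ +_) (mkℚ-pos≡ratio m n c)) (trans (ℚP.+-comm 1ℚ (ratio m n)) (sym (ratio-suc n m)))
    nz' : 1ℚ - x ≢ 0ℚ
    nz' e = ratio-≢0 (suc n ℕ.+ m) n (trans (sym 1-x≡ratio) e)

lemma1 : (N : ℕ) → 5 ≤ N → N % 2 ≡ 1 →
    (c : ℕ → ℚ) → (p : Poly) →
    let C = λ (x : ℚ) → sum1 ((N ∸ 3) / 2) (λ n → c (2 ℕ.* n) * pow x (2 ℕ.* n)) in
    Σ ℚ (λ c₀ → Σ Poly (λ O → IsOdd O ×
      (∀ (x : ℚ) (nz : x ≢ 0ℚ) →
        (C x - C (1ℚ + x)) - pow x (N ∸ 2) * C (1ℚ + inv x nz) ≡ c₀ + eval O x))) →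
    (∀ (x : ℚ) → C x ≡ x * eval p x) →
    (∀ (x : ℚ) (nz : x ≢ 0ℚ) → eval p x ≡ pow x (N ∸ 3) * eval p (inv x nz)) →
    InW+ (N ∸ 1) p
lemma1 _ (s≤s (s≤s (s≤s (s≤s (s≤s {n = m} z≤n))))) N-odd c p (c₀ , O , O-odd , C-relation) C≡x*p p-reciprocal =
  (two-term-relation , λ x nz nz₁ → trans (three-term≡T x nz nz₁) (T-vanishes x nz (x≢1 nz₁))) ,
  eval-odd⇒eval-0≡0 p P-odd ,
  p-reciprocal
  where
  w = suc (suc m)
  C : ℚ → ℚ
  C x = sum1 (w / 2) (λ n → c (2 ℕ.* n) * pow x (2 ℕ.* n))
  open ThreeTermRelation w (suc-odd⇒even w N-odd) (pow-2-≢-1 (suc m)) (eval p) C (eval O) c₀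
    C≡x*p (even-poly-neg (w / 2) c) p-reciprocal O-odd C-relation
  x≢1 : ∀ {x} → x - 1ℚ ≢ 0ℚ → x ≢ 1ℚ
  x≢1 nz₁ x≡1 = nz₁ (x≈y⇒x∙y⁻¹≈ε x≡1)
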